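{- Let $1\le\delta<\Delta$ be integers and let $G$ be a graph with minimum degree $\delta$ and maximum degree $\Delta$. If $\Delta(\delta+1)$ is even, then $\Pi_1(G)\ge\delta^{2\Delta}\Delta^2$, $NK(G)\ge\delta^{\Delta}\Delta$, $NK^*(G)\ge\delta^{\delta\Delta}\Delta^{\Delta}$. If $\Delta(\delta+1)$ is odd, then $\Pi_1(G)\ge\delta^{2(\Delta-1)}(\delta+1)^2\Delta^2$, $NK(G)\ge\delta^{\Delta-1}(\delta+1)\Delta$, $NK^*(G)\ge\delta^{\delta(\Delta-1)}(\delta+1)^{\delta+1}\Delta^{\Delta}$. These inequalities are sharp.
   Context: All graphs are finite, simple and have at least one edge; $d_u$ is the degree of $u$. $\Pi_1(G)=\prod_{u\in V(G)}d_u^2$ (first multiplicative Zagreb index), $NK(G)=\prod_{u\in V(G)}d_u$ (Narumi–Katayama index), $NK^*(G)=\prod_{u\in V(G)}d_u^{d_u}$ (modified Narumi–Katayama index). -}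

module Defs where

open import Data.Nat using (ℕ; _≤_; _^_; _*_)
open import Data.Fin using (Fin)
open import Data.Bool using (Bool; true; false; if_then_else_)
open import Data.List using (List; map; allFin)
open import Data.Nat.ListAction using (sum; product)
open import Data.Product using (Σ; _×_)
open import Relation.Binary.PropositionalEquality using (_≡_)

record Graph : Set where
  field
    n      : ℕ
    adj    : Fin n → Fin n → Bool
    sym    : ∀ i j → adj i j ≡ adj j i
    irrefl : ∀ i → adj i i ≡ false
open Graph public

deg : (G : Graph) → Fin (n G) → ℕ
deg G i = sum (map (λ j → if adj G i j then 1 else 0) (allFin (n G)))

prodV : (G : Graph) → (Fin (n G) → ℕ) → ℕ
prodV G f = product (map f (allFin (n G)))

Π₁ : Graph → ℕ
Π₁ G = prodV G (λ u → deg G u ^ 2)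

NK : Graph → ℕ
NK G = prodV G (λ u → deg G u)

NK* : Graph → ℕ
NK* G = prodV G (λ u → deg G u ^ deg G u)

MinDeg : Graph → ℕ → Set
MinDeg G δ = Σ (Fin (n G)) (λ i → deg G i ≡ δ) × (∀ i → δ ≤ deg G i)

MaxDeg : Graph → ℕ → Set
MaxDeg G Δ = Σ (Fin (n G)) (λ i → deg G i ≡ Δ) × (∀ i → deg G i ≤ Δ)

DegBounds : Graph → ℕ → ℕ → Set
DegBounds G δ Δ = MinDeg G δ × MaxDeg G Δ

-- Each index is ∏ᵤ F (d u) for a monotone F with F δ ≥ 1 (F x = x², x, x ^ x). A vertex of degree Δ
-- forces at least Δ + 1 vertices, all of degree ≥ δ, so the product is at least F δ ^ Δ · F Δ. If Δ is
-- odd and δ even, the other vertices cannot all have degree δ, as the degree sum Δ + (n - 1) δ would be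
-- odd; one of them has degree ≥ δ + 1, which gives F δ ^ (Δ - 1) · F (δ + 1) · F Δ. Both bounds are
-- attained by a vertex joined to a graph on {0, …, Δ - 1} with degrees δ - 1 (one vertex δ in the odd
-- case): the circulant graph joining vertices at cyclic distance 1, …, ⌊(δ - 1)/2⌋, plus, for even δ,
-- the chords {i, i + ⌊Δ/2⌋}.

module Submission where

open import Data.Bool using (Bool; true; false; if_then_else_; _∧_; _∨_)
open import Data.Bool.Properties using (∨-comm; ∨-zeroʳ; ∧-zeroʳ)
open import Data.Empty using (⊥-elim)
open import Data.Fin using (Fin; zero; suc; toℕ; fromℕ<) renaming (_≟_ to _≟ᶠ_)
open import Data.Fin.Properties using (any?; toℕ<n; toℕ-fromℕ<) renaming (suc-injective to Fin-suc-injective)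
open import Data.List using (tabulate)
open import Data.List.Properties using (map-tabulate; tabulate-cong)
open import Data.Nat using (ℕ; zero; suc; _+_; _*_; _^_; _∸_; _≤_; _<_; z≤n; s≤s; s≤s⁻¹; z<s; s<s;
                            _≤?_; _<?_; ∣_-_∣)
open import Data.Nat.Divisibility
  using (_∣_; divides; ∣m∣n⇒∣m+n; ∣m+n∣m⇒∣n; m∣m*n; n∣m*n; ∣1⇒≡1; ∣-refl; ∣-trans)
open import Data.Nat.ListAction using (sum; product)
open import Data.Nat.Primality using (euclidsLemma; prime[2])
open import Data.Nat.Properties
open import Data.Product using (Σ; ∃; _×_; _,_; proj₁; proj₂)
open import Data.Sum using (_⊎_; inj₁; inj₂; [_,_]′)
open import Function using (id; _∘_)
open import Function.Bundles using (_⇔_; mk⇔)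
open import Relation.Binary.Definitions using (Monotonic₁; tri<; tri≈; tri>)
open import Relation.Binary.PropositionalEquality
open import Relation.Nullary using (¬_; yes; no; does; contradiction)
open import Relation.Nullary.Decidable using (_×-dec_; ¬?; dec-true; dec-false; does-⇔)
import Algebra.Properties.CommutativeSemigroup as CommSemigroupProperties

open import Defs hiding (sym)

module + = CommSemigroupProperties +-commutativeSemigroup
module * = CommSemigroupProperties *-commutativeSemigroup

parity : ∀ n → (∃ λ q → n ≡ q + q) ⊎ (∃ λ q → n ≡ suc (q + q))
parity zero = inj₁ (0 , refl)
parity (suc n) with parity n
... | inj₁ (q , refl) = inj₂ (q , refl)
... | inj₂ (q , refl) = inj₁ (suc q , cong suc (sym (+-suc q q)))

2∣double : ∀ q → 2 ∣ q + q
2∣double q = divides q (trans (cong (q +_) (sym (+-identityʳ q))) (*-comm 2 q))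

2∤odd : ∀ q → ¬ 2 ∣ suc (q + q)
2∤odd q 2∣odd with ∣1⇒≡1 (∣m+n∣m⇒∣n (subst (2 ∣_) (+-comm 1 (q + q)) 2∣odd) (2∣double q))
... | ()

2∤*suc⇒2∤×2∣ : ∀ m n → ¬ 2 ∣ m * suc n → ¬ 2 ∣ m × 2 ∣ n
2∤*suc⇒2∤×2∣ m n 2∤m*[1+n] = (λ 2∣m → 2∤m*[1+n] (∣-trans 2∣m (m∣m*n (suc n)))) , 2∣n
  where
  2∣n : 2 ∣ n
  2∣n with parity n
  ... | inj₁ (q , refl) = 2∣double q
  ... | inj₂ (q , refl) = contradiction (∣-trans (∣m∣n⇒∣m+n ∣-refl (2∣double q)) (n∣m*n m)) 2∤m*[1+n]

double-<⇒< : ∀ {m n} → m + m < n + n → m < n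
double-<⇒< {m} {n} 2m<2n = ≰⇒> (λ n≤m → <⇒≱ 2m<2n (+-mono-≤ n≤m n≤m))

^-self-mono : Monotonic₁ _≤_ _≤_ (λ x → x ^ x)
^-self-mono {zero}  {zero}  _   = ≤-refl
^-self-mono {zero}  {suc y} _   = m^n>0 (suc y) (suc y)
^-self-mono {suc x} {suc y} x≤y = ≤-trans (^-monoˡ-≤ (suc x) x≤y) (^-monoʳ-≤ (suc y) x≤y)

indicator : Bool → ℕ
indicator b = if b then 1 else 0

indicator≤1 : ∀ b → indicator b ≤ 1
indicator≤1 true  = ≤-refl
indicator≤1 false = z≤n

indicator-∨ : ∀ b c → (b ≡ true → c ≡ false) → indicator (b ∨ c) ≡ indicator b + indicator c
indicator-∨ true  c b⇒¬c rewrite b⇒¬c refl = refl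
indicator-∨ false c b⇒¬c = refl

deg≡sum-tabulate : ∀ G i → deg G i ≡ sum (tabulate (λ j → indicator (adj G i j)))
deg≡sum-tabulate G i = cong sum (map-tabulate id (indicator ∘ adj G i))

prodV≡product-tabulate : ∀ G f → prodV G f ≡ product (tabulate f)
prodV≡product-tabulate G f = cong product (map-tabulate id f)

sum-tabulate-+ : ∀ {N} (f g : Fin N → ℕ) →
                 sum (tabulate (λ i → f i + g i)) ≡ sum (tabulate f) + sum (tabulate g)
sum-tabulate-+ {zero}  f g = refl
sum-tabulate-+ {suc N} f g = begin
  f zero + g zero + sum (tabulate (λ i → f (suc i) + g (suc i)))
    ≡⟨ cong (f zero + g zero +_) (sum-tabulate-+ (f ∘ suc) (g ∘ suc)) ⟩
  f zero + g zero + (sum (tabulate (f ∘ suc)) + sum (tabulate (g ∘ suc)))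
    ≡⟨ +.interchange (f zero) (g zero) _ _ ⟩
  f zero + sum (tabulate (f ∘ suc)) + (g zero + sum (tabulate (g ∘ suc))) ∎
  where open ≡-Reasoning

sum-tabulate-symmetric-even : ∀ {N} (a : Fin N → Fin N → ℕ) →
                              (∀ i j → a i j ≡ a j i) → (∀ i → a i i ≡ 0) →
                              2 ∣ sum (tabulate (λ i → sum (tabulate (a i))))
sum-tabulate-symmetric-even {zero}  a a-sym a-diag = divides 0 refl
sum-tabulate-symmetric-even {suc N} a a-sym a-diag =
  subst (2 ∣_) (sym split) (∣m∣n⇒∣m+n (m∣m*n row)
                                      (sum-tabulate-symmetric-even (λ i j → a (suc i) (suc j))
                                        (λ i j → a-sym (suc i) (suc j)) (a-diag ∘ suc)))
  where
  open ≡-Reasoning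
  row = sum (tabulate (λ j → a zero (suc j)))
  rest = sum (tabulate (λ i → sum (tabulate (λ j → a (suc i) (suc j)))))
  split : a zero zero + row + sum (tabulate (λ i → a (suc i) zero + sum (tabulate (λ j → a (suc i) (suc j)))))
          ≡ 2 * row + rest
  split = begin
    a zero zero + row + sum (tabulate (λ i → a (suc i) zero + sum (tabulate (λ j → a (suc i) (suc j)))))
      ≡⟨ cong₂ (λ d s → d + row + s) (a-diag zero) (sum-tabulate-+ (λ i → a (suc i) zero) _) ⟩
    row + (sum (tabulate (λ i → a (suc i) zero)) + rest)
      ≡⟨ cong (λ c → row + (c + rest)) (cong sum (tabulate-cong (λ i → a-sym (suc i) zero))) ⟩
    row + (row + rest)
      ≡⟨ +-assoc row row rest ⟨
    row + row + rest
      ≡⟨ cong (λ r → row + r + rest) (+-identityʳ row) ⟨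
    2 * row + rest ∎

degree-sum-even : ∀ G → 2 ∣ sum (tabulate (deg G))
degree-sum-even G =
  subst (2 ∣_) (cong sum (tabulate-cong (sym ∘ deg≡sum-tabulate G)))
    (sum-tabulate-symmetric-even (λ i j → indicator (adj G i j))
      (λ i j → cong indicator (Graph.sym G i j)) (λ i → cong indicator (irrefl G i)))

sum-tabulate-≤1 : ∀ {N} (f : Fin N → ℕ) → (∀ j → f j ≤ 1) → sum (tabulate f) ≤ N
sum-tabulate-≤1 {zero}  f f≤1 = z≤n
sum-tabulate-≤1 {suc N} f f≤1 = +-mono-≤ (f≤1 zero) (sum-tabulate-≤1 (f ∘ suc) (f≤1 ∘ suc))

sum-tabulate-≤1-zero-< : ∀ {N} (f : Fin N → ℕ) → (∀ j → f j ≤ 1) → ∀ v → f v ≡ 0 →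
                         sum (tabulate f) < N
sum-tabulate-≤1-zero-< {suc N} f f≤1 zero    fv≡0 rewrite fv≡0 = s≤s (sum-tabulate-≤1 (f ∘ suc) (f≤1 ∘ suc))
sum-tabulate-≤1-zero-< {suc N} f f≤1 (suc v) fv≡0 =
  ≤-trans (+-monoˡ-< _ (s≤s (f≤1 zero))) (s≤s (sum-tabulate-≤1-zero-< (f ∘ suc) (f≤1 ∘ suc) v fv≡0))

deg<n : ∀ G i → deg G i < n G
deg<n G i = subst (_< n G) (sym (deg≡sum-tabulate G i))
  (sum-tabulate-≤1-zero-< _ (indicator≤1 ∘ adj G i) i (cong indicator (irrefl G i)))

∣-sum-tabulate : ∀ {N d} (f : Fin N → ℕ) → (∀ j → d ∣ f j) → d ∣ sum (tabulate f)
∣-sum-tabulate {zero}  f d∣f = divides 0 refl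
∣-sum-tabulate {suc N} f d∣f = ∣m∣n⇒∣m+n (d∣f zero) (∣-sum-tabulate (f ∘ suc) (d∣f ∘ suc))

∣-sum-tabulate-except : ∀ {N d} (f : Fin N → ℕ) v → (∀ j → j ≢ v → d ∣ f j) →
                        d ∣ sum (tabulate f) → d ∣ f v
∣-sum-tabulate-except {suc N} {d} f zero d∣f d∣sum =
  ∣m+n∣m⇒∣n (subst (d ∣_) (+-comm (f zero) (sum (tabulate (f ∘ suc)))) d∣sum)
            (∣-sum-tabulate (f ∘ suc) (λ j → d∣f (suc j) λ ()))
∣-sum-tabulate-except {suc N} f (suc v) d∣f d∣sum =
  ∣-sum-tabulate-except (f ∘ suc) v (λ j j≢v → d∣f (suc j) (j≢v ∘ Fin-suc-injective))
    (∣m+n∣m⇒∣n d∣sum (d∣f zero λ ()))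

pow≤product-tabulate : ∀ {N a} (f : Fin N → ℕ) → (∀ j → a ≤ f j) → a ^ N ≤ product (tabulate f)
pow≤product-tabulate {zero}  f a≤f = ≤-refl
pow≤product-tabulate {suc N} f a≤f = *-mono-≤ (a≤f zero) (pow≤product-tabulate (f ∘ suc) (a≤f ∘ suc))

pow*≤product-tabulate : ∀ {N a} (f : Fin (suc N) → ℕ) → (∀ j → a ≤ f j) → ∀ v →
                        a ^ N * f v ≤ product (tabulate f)
pow*≤product-tabulate {N} {a} f a≤f zero = begin
  a ^ N * f zero                   ≤⟨ *-monoˡ-≤ (f zero) (pow≤product-tabulate (f ∘ suc) (a≤f ∘ suc)) ⟩
  product (tabulate (f ∘ suc)) * f zero ≡⟨ *-comm _ (f zero) ⟩
  product (tabulate f)             ∎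
  where open ≤-Reasoning
pow*≤product-tabulate {suc N} {a} f a≤f (suc v) = begin
  a * a ^ N * f (suc v)             ≡⟨ *-assoc a (a ^ N) _ ⟩
  a * (a ^ N * f (suc v))           ≤⟨ *-mono-≤ (a≤f zero) (pow*≤product-tabulate (f ∘ suc) (a≤f ∘ suc) v) ⟩
  product (tabulate f)              ∎
  where open ≤-Reasoning

pow**≤product-tabulate : ∀ {N a} (f : Fin (suc (suc N)) → ℕ) → (∀ j → a ≤ f j) → ∀ v w → v ≢ w →
                         a ^ N * f v * f w ≤ product (tabulate f)
pow**≤product-tabulate f a≤f zero    zero    v≢w = ⊥-elim (v≢w refl)
pow**≤product-tabulate {N} {a} f a≤f zero    (suc w) v≢w = begin
  a ^ N * f zero * f (suc w)         ≡⟨ *.xy∙z≈xz∙y (a ^ N) (f zero) _ ⟩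
  a ^ N * f (suc w) * f zero         ≤⟨ *-monoˡ-≤ (f zero) (pow*≤product-tabulate (f ∘ suc) (a≤f ∘ suc) w) ⟩
  product (tabulate (f ∘ suc)) * f zero ≡⟨ *-comm _ (f zero) ⟩
  product (tabulate f)               ∎
  where open ≤-Reasoning
pow**≤product-tabulate {N} {a} f a≤f (suc v) zero    v≢w = begin
  a ^ N * f (suc v) * f zero         ≤⟨ *-monoˡ-≤ (f zero) (pow*≤product-tabulate (f ∘ suc) (a≤f ∘ suc) v) ⟩
  product (tabulate (f ∘ suc)) * f zero ≡⟨ *-comm _ (f zero) ⟩
  product (tabulate f)               ∎
  where open ≤-Reasoning
pow**≤product-tabulate {zero} f a≤f (suc zero) (suc zero) v≢w = ⊥-elim (v≢w refl)
pow**≤product-tabulate {suc N} {a} f a≤f (suc v) (suc w) v≢w = begin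
  a * a ^ N * f (suc v) * f (suc w)     ≡⟨ cong (_* f (suc w)) (*-assoc a (a ^ N) _) ⟩
  a * (a ^ N * f (suc v)) * f (suc w)   ≡⟨ *-assoc a _ _ ⟩
  a * (a ^ N * f (suc v) * f (suc w))   ≤⟨ *-mono-≤ (a≤f zero)
                                             (pow**≤product-tabulate (f ∘ suc) (a≤f ∘ suc) v w (v≢w ∘ cong suc)) ⟩
  product (tabulate f)                  ∎
  where open ≤-Reasoning

pow*≤product-tabulate-< : ∀ {N a c} (f : Fin N → ℕ) → 1 ≤ a → (∀ j → a ≤ f j) → ∀ v → c < N →
                          a ^ c * f v ≤ product (tabulate f)
pow*≤product-tabulate-< {suc N} {suc a} {c} f _ a≤f v (s≤s c≤N) =
  ≤-trans (*-monoˡ-≤ (f v) (^-monoʳ-≤ (suc a) c≤N)) (pow*≤product-tabulate f a≤f v)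

pow**≤product-tabulate-< : ∀ {N a c} (f : Fin N → ℕ) → 1 ≤ a → (∀ j → a ≤ f j) → ∀ v w → v ≢ w →
                           suc c < N → a ^ c * f v * f w ≤ product (tabulate f)
pow**≤product-tabulate-< {suc (suc N)} {suc a} {c} f _ a≤f v w v≢w (s≤s (s≤s c≤N)) =
  ≤-trans (*-monoˡ-≤ (f w) (*-monoˡ-≤ (f v) (^-monoʳ-≤ (suc a) c≤N)))
          (pow**≤product-tabulate f a≤f v w v≢w)

-- Otherwise all degrees but deg v = Δ equal the even δ, and the degree sum would be odd.
vertex-above-min : ∀ G {δ Δ} → ¬ 2 ∣ Δ → 2 ∣ δ → (∀ i → δ ≤ deg G i) → ∀ v → deg G v ≡ Δ →
                   ∃ λ w → w ≢ v × δ < deg G w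
vertex-above-min G {δ} 2∤Δ 2∣δ δ≤deg v degv≡Δ
  with any? (λ w → ¬? (w ≟ᶠ v) ×-dec (suc δ ≤? deg G w))
... | yes (w , w≢v , δ<degw) = w , w≢v , δ<degw
... | no ∄w = ⊥-elim (2∤Δ (subst (2 ∣_) degv≡Δ
                 (∣-sum-tabulate-except (deg G) v 2∣deg (degree-sum-even G))))
  where
  2∣deg : ∀ j → j ≢ v → 2 ∣ deg G j
  2∣deg j j≢v = subst (2 ∣_) (≤-antisym (δ≤deg j) (≮⇒≥ (λ δ<degj → ∄w (j , j≢v , δ<degj)))) 2∣δ

module _ (G : Graph) {δ Δ : ℕ} (F : ℕ → ℕ) (F-mono : Monotonic₁ _≤_ _≤_ F) (1≤Fδ : 1 ≤ F δ) where

  prodV-deg-≥ : DegBounds G δ Δ → F δ ^ Δ * F Δ ≤ prodV G (F ∘ deg G)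
  prodV-deg-≥ (( _ , δ≤deg) , ((v , degv≡Δ) , _)) rewrite prodV≡product-tabulate G (F ∘ deg G) =
    subst (λ d → F δ ^ Δ * F d ≤ _) degv≡Δ
      (pow*≤product-tabulate-< (F ∘ deg G) 1≤Fδ (F-mono ∘ δ≤deg) v (subst (_< n G) degv≡Δ (deg<n G v)))

  prodV-deg-≥-odd : ¬ 2 ∣ Δ → 2 ∣ δ → DegBounds G δ Δ →
                    F δ ^ (Δ ∸ 1) * F (suc δ) * F Δ ≤ prodV G (F ∘ deg G)
  prodV-deg-≥-odd 2∤Δ 2∣δ ((_ , δ≤deg) , ((v , degv≡Δ) , deg≤Δ))
    rewrite prodV≡product-tabulate G (F ∘ deg G)
    with vertex-above-min G 2∤Δ 2∣δ δ≤deg v degv≡Δ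
  ... | w , w≢v , δ<degw = begin
    F δ ^ (Δ ∸ 1) * F (suc δ) * F Δ       ≤⟨ *-monoˡ-≤ (F Δ) (*-monoʳ-≤ (F δ ^ (Δ ∸ 1)) (F-mono δ<degw)) ⟩
    F δ ^ (Δ ∸ 1) * F (deg G w) * F Δ     ≡⟨ cong (λ d → F δ ^ (Δ ∸ 1) * F (deg G w) * F d) degv≡Δ ⟨
    F δ ^ (Δ ∸ 1) * F (deg G w) * F (deg G v)
      ≤⟨ pow**≤product-tabulate-< (F ∘ deg G) 1≤Fδ (F-mono ∘ δ≤deg) w v w≢v Δ∸1<n-1 ⟩
    product (tabulate (F ∘ deg G))        ∎
    where
    open ≤-Reasoning
    1≤Δ : 1 ≤ Δ
    1≤Δ = ≤-trans (s≤s z≤n) (≤-trans δ<degw (deg≤Δ w))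
    Δ∸1<n-1 : suc (Δ ∸ 1) < n G
    Δ∸1<n-1 = subst (_< n G) (trans degv≡Δ (sym (m+[n∸m]≡n 1≤Δ))) (deg<n G v)

sumBelow : ℕ → (ℕ → ℕ) → ℕ
sumBelow zero    f = 0
sumBelow (suc n) f = f 0 + sumBelow n (f ∘ suc)

productBelow : ℕ → (ℕ → ℕ) → ℕ
productBelow zero    f = 1
productBelow (suc n) f = f 0 * productBelow n (f ∘ suc)

sumBelow-cong : ∀ n {f g : ℕ → ℕ} → (∀ x → x < n → f x ≡ g x) → sumBelow n f ≡ sumBelow n g
sumBelow-cong zero    f≡g = refl
sumBelow-cong (suc n) f≡g = cong₂ _+_ (f≡g 0 z<s) (sumBelow-cong n (λ x x<n → f≡g (suc x) (s<s x<n)))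

sumBelow-+ : ∀ m n (f : ℕ → ℕ) → sumBelow (m + n) f ≡ sumBelow m f + sumBelow n (λ x → f (m + x))
sumBelow-+ zero    n f = refl
sumBelow-+ (suc m) n f = trans (cong (f 0 +_) (sumBelow-+ m n (f ∘ suc))) (sym (+-assoc (f 0) _ _))

sumBelow-const : ∀ n {c f} → (∀ x → x < n → f x ≡ c) → sumBelow n f ≡ n * c
sumBelow-const zero    f≡c = refl
sumBelow-const (suc n) f≡c = cong₂ _+_ (f≡c 0 z<s) (sumBelow-const n (λ x x<n → f≡c (suc x) (s<s x<n)))

sumBelow-distrib : ∀ n (f g : ℕ → ℕ) → sumBelow n (λ x → f x + g x) ≡ sumBelow n f + sumBelow n g
sumBelow-distrib zero    f g = refl
sumBelow-distrib (suc n) f g =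
  trans (cong (f 0 + g 0 +_) (sumBelow-distrib n (f ∘ suc) (g ∘ suc))) (+.interchange (f 0) (g 0) _ _)

productBelow-const : ∀ n {c f} → (∀ x → x < n → f x ≡ c) → productBelow n f ≡ c ^ n
productBelow-const zero    f≡c = refl
productBelow-const (suc n) f≡c = cong₂ _*_ (f≡c 0 z<s) (productBelow-const n (λ x x<n → f≡c (suc x) (s<s x<n)))

productBelow-except : ∀ n {c f} s → s < n → (∀ x → x < n → x ≢ s → f x ≡ c) →
                      productBelow n f ≡ c ^ (n ∸ 1) * f s
productBelow-except (suc n) {c} {f} zero _ f≡c = begin
  f 0 * productBelow n (f ∘ suc) ≡⟨ cong (f 0 *_) (productBelow-const n (λ x x<n → f≡c (suc x) (s<s x<n) λ ())) ⟩
  f 0 * c ^ n                   ≡⟨ *-comm (f 0) (c ^ n) ⟩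
  c ^ n * f 0                   ∎
  where open ≡-Reasoning
productBelow-except (suc (suc n)) {c} {f} (suc s) (s<s s<n) f≡c = begin
  f 0 * productBelow (suc n) (f ∘ suc)
    ≡⟨ cong₂ _*_ (f≡c 0 z<s λ ()) (productBelow-except (suc n) s s<n
                                     (λ x x<n x≢s → f≡c (suc x) (s<s x<n) (x≢s ∘ suc-injective))) ⟩
  c * (c ^ n * f (suc s))  ≡⟨ *-assoc c (c ^ n) _ ⟨
  c * c ^ n * f (suc s)    ∎
  where open ≡-Reasoning

sum-tabulate≡sumBelow : ∀ {n} (g : Fin n → ℕ) h → (∀ j → g j ≡ h (toℕ j)) → sum (tabulate g) ≡ sumBelow n h
sum-tabulate≡sumBelow {zero}  g h g≡h = refl
sum-tabulate≡sumBelow {suc n} g h g≡h =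
  cong₂ _+_ (g≡h zero) (sum-tabulate≡sumBelow (g ∘ suc) (h ∘ suc) (g≡h ∘ suc))

product-tabulate≡productBelow : ∀ {n} (g : Fin n → ℕ) h → (∀ j → g j ≡ h (toℕ j)) →
                                product (tabulate g) ≡ productBelow n h
product-tabulate≡productBelow {zero}  g h g≡h = refl
product-tabulate≡productBelow {suc n} g h g≡h =
  cong₂ _*_ (g≡h zero) (product-tabulate≡productBelow (g ∘ suc) (h ∘ suc) (g≡h ∘ suc))

sumBelow-suc : ∀ n (f : ℕ → ℕ) → sumBelow (suc n) f ≡ sumBelow n f + f n
sumBelow-suc zero    f = +-identityʳ (f 0)
sumBelow-suc (suc n) f = trans (cong (f 0 +_) (sumBelow-suc n (f ∘ suc))) (sym (+-assoc (f 0) _ _))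

sumBelow-reverse : ∀ n (f : ℕ → ℕ) → sumBelow n (λ y → f (n ∸ y)) ≡ sumBelow n (f ∘ suc)
sumBelow-reverse zero    f = refl
sumBelow-reverse (suc n) f = begin
  f (suc n) + sumBelow n (λ y → f (n ∸ y)) ≡⟨ cong (f (suc n) +_) (sumBelow-reverse n f) ⟩
  f (suc n) + sumBelow n (f ∘ suc)         ≡⟨ +-comm (f (suc n)) _ ⟩
  sumBelow n (f ∘ suc) + f (suc n)         ≡⟨ sumBelow-suc n (f ∘ suc) ⟨
  sumBelow (suc n) (f ∘ suc)               ∎
  where open ≡-Reasoning

sumBelow-≟ : ∀ n e → sumBelow n (λ x → indicator (does (x ≟ e))) ≡ indicator (does (e <? n))
sumBelow-≟ zero    e       = refl
sumBelow-≟ (suc n) zero    = cong suc (trans (sumBelow-const n (λ _ _ → refl)) (*-zeroʳ n))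
sumBelow-≟ (suc n) (suc e) = sumBelow-≟ n e

sumBelow-distance-split : ∀ {i m} (f : ℕ → ℕ) → i ≤ m →
  sumBelow m (λ y → f ∣ i - y ∣) ≡ sumBelow i (λ y → f (i ∸ y)) + sumBelow (m ∸ i) f
sumBelow-distance-split {i} {m} f i≤m = begin
  sumBelow m (λ y → f ∣ i - y ∣)
    ≡⟨ cong (λ k → sumBelow k (λ y → f ∣ i - y ∣)) (m+[n∸m]≡n i≤m) ⟨
  sumBelow (i + (m ∸ i)) (λ y → f ∣ i - y ∣)
    ≡⟨ sumBelow-+ i (m ∸ i) _ ⟩
  sumBelow i (λ y → f ∣ i - y ∣) + sumBelow (m ∸ i) (λ x → f ∣ i - i + x ∣)
    ≡⟨ cong₂ _+_ (sumBelow-cong i (λ y y<i → cong f (m≤n⇒∣n-m∣≡n∸m (<⇒≤ y<i))))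
                 (sumBelow-cong (m ∸ i) (λ x _ → cong f (∣m-m+n∣≡n i x))) ⟩
  sumBelow i (λ y → f (i ∸ y)) + sumBelow (m ∸ i) f ∎
  where open ≡-Reasoning

-- Summing f over the distances from i is a rotation of summing it over {0, …, m - 1}.
sumBelow-distance-reflect : ∀ {i m} (f : ℕ → ℕ) → (∀ x y → 0 < x → 0 < y → x + y ≡ m → f x ≡ f y) →
                            i < m →
                            sumBelow m (λ y → f ∣ i - y ∣) ≡ sumBelow m f
sumBelow-distance-reflect {i} {m} f f-reflect i<m = begin
  sumBelow m (λ y → f ∣ i - y ∣)
    ≡⟨ sumBelow-distance-split f (<⇒≤ i<m) ⟩
  sumBelow i (λ y → f (i ∸ y)) + sumBelow (m ∸ i) f
    ≡⟨ cong (_+ sumBelow (m ∸ i) f) (sumBelow-cong i reflect) ⟩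
  sumBelow i (λ y → f (m ∸ i + y)) + sumBelow (m ∸ i) f
    ≡⟨ +-comm _ (sumBelow (m ∸ i) f) ⟩
  sumBelow (m ∸ i) f + sumBelow i (λ y → f (m ∸ i + y))
    ≡⟨ sumBelow-+ (m ∸ i) i f ⟨
  sumBelow (m ∸ i + i) f
    ≡⟨ cong (λ k → sumBelow k f) (m∸n+n≡m (<⇒≤ i<m)) ⟩
  sumBelow m f ∎
  where
  open ≡-Reasoning
  reflect : ∀ y → y < i → f (i ∸ y) ≡ f (m ∸ i + y)
  reflect y y<i = f-reflect _ _ (m<n⇒0<n∸m y<i) (≤-trans (m<n⇒0<n∸m i<m) (m≤m+n (m ∸ i) y)) (begin
    i ∸ y + (m ∸ i + y) ≡⟨ +-comm (i ∸ y) _ ⟩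
    m ∸ i + y + (i ∸ y) ≡⟨ +-assoc (m ∸ i) y (i ∸ y) ⟩
    m ∸ i + (y + (i ∸ y)) ≡⟨ cong (m ∸ i +_) (m+[n∸m]≡n (<⇒≤ y<i)) ⟩
    m ∸ i + i ≡⟨ m∸n+n≡m (<⇒≤ i<m) ⟩
    m ∎)

distanceDegree : ℕ → (ℕ → Bool) → ℕ → ℕ
distanceDegree m D i = sumBelow m (λ y → indicator (D ∣ i - y ∣))

module _ {m : ℕ} (D : ℕ → Bool) where

  coneAdj : Fin (suc m) → Fin (suc m) → Bool
  coneAdj zero    zero    = false
  coneAdj zero    (suc j) = true
  coneAdj (suc i) zero    = true
  coneAdj (suc i) (suc j) = D ∣ toℕ i - toℕ j ∣

  coneAdj-sym : ∀ i j → coneAdj i j ≡ coneAdj j i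
  coneAdj-sym zero    zero    = refl
  coneAdj-sym zero    (suc j) = refl
  coneAdj-sym (suc i) zero    = refl
  coneAdj-sym (suc i) (suc j) = cong D (∣-∣-comm (toℕ i) (toℕ j))

  coneAdj-irrefl : D 0 ≡ false → ∀ i → coneAdj i i ≡ false
  coneAdj-irrefl D0 zero    = refl
  coneAdj-irrefl D0 (suc i) = trans (cong D (∣n-n∣≡0 (toℕ i))) D0

cone : ∀ m (D : ℕ → Bool) → D 0 ≡ false → Graph
cone m D D0 = record { n = suc m ; adj = coneAdj D ; sym = coneAdj-sym D ; irrefl = coneAdj-irrefl D D0 }

module _ {m : ℕ} {D : ℕ → Bool} {D0 : D 0 ≡ false} where

  deg-cone-apex : deg (cone m D D0) zero ≡ m
  deg-cone-apex = begin
    deg (cone m D D0) zero                  ≡⟨ deg≡sum-tabulate (cone m D D0) zero ⟩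
    sum (tabulate (λ (j : Fin m) → 1))      ≡⟨ sum-tabulate≡sumBelow {m} (λ _ → 1) (λ _ → 1) (λ _ → refl) ⟩
    sumBelow m (λ _ → 1)                    ≡⟨ sumBelow-const m (λ _ _ → refl) ⟩
    m * 1                                   ≡⟨ *-identityʳ m ⟩
    m                                       ∎
    where open ≡-Reasoning

  deg-cone-suc : ∀ i → deg (cone m D D0) (suc i) ≡ suc (distanceDegree m D (toℕ i))
  deg-cone-suc i = trans (deg≡sum-tabulate (cone m D D0) (suc i))
    (cong suc (sum-tabulate≡sumBelow {m} (λ j → indicator (D ∣ toℕ i - toℕ j ∣))
                                         (λ y → indicator (D ∣ toℕ i - y ∣)) (λ _ → refl)))

  prodV-cone : ∀ F → prodV (cone m D D0) (F ∘ deg (cone m D D0)) ≡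
                     productBelow m (F ∘ suc ∘ distanceDegree m D) * F m
  prodV-cone F = begin
    prodV (cone m D D0) (F ∘ deg (cone m D D0))
      ≡⟨ prodV≡product-tabulate (cone m D D0) (F ∘ deg (cone m D D0)) ⟩
    F (deg (cone m D D0) zero) * product (tabulate (F ∘ deg (cone m D D0) ∘ suc))
      ≡⟨ cong₂ _*_ (cong F deg-cone-apex)
           (product-tabulate≡productBelow {m} (F ∘ deg (cone m D D0) ∘ suc) (F ∘ suc ∘ distanceDegree m D)
                                              (cong F ∘ deg-cone-suc)) ⟩
    F m * productBelow m (F ∘ suc ∘ distanceDegree m D)
      ≡⟨ *-comm (F m) _ ⟩
    productBelow m (F ∘ suc ∘ distanceDegree m D) * F m ∎
    where open ≡-Reasoning

  cone-DegBounds : ∀ {δ} → δ ≤ m →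
                   (∀ i → i < m → δ ≤ suc (distanceDegree m D i) × suc (distanceDegree m D i) ≤ m) →
                   ∀ i₀ → (i₀<m : i₀ < m) → suc (distanceDegree m D i₀) ≡ δ → DegBounds (cone m D D0) δ m
  cone-DegBounds {δ} δ≤m bounds i₀ i₀<m i₀-min =
    ((suc (fromℕ< i₀<m) , trans (deg-cone-suc _) (trans (cong (suc ∘ distanceDegree m D) (toℕ-fromℕ< i₀<m)) i₀-min))
    , lower) ,
    ((zero , deg-cone-apex) , upper)
    where
    lower : ∀ i → δ ≤ deg (cone m D D0) i
    lower zero    = subst (δ ≤_) (sym deg-cone-apex) δ≤m
    lower (suc i) = subst (δ ≤_) (sym (deg-cone-suc i)) (proj₁ (bounds (toℕ i) (toℕ<n i)))
    upper : ∀ i → deg (cone m D D0) i ≤ m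
    upper zero    = ≤-reflexive deg-cone-apex
    upper (suc i) = subst (_≤ m) (sym (deg-cone-suc i)) (proj₂ (bounds (toℕ i) (toℕ<n i)))

ExtremalGraph : ℕ → ℕ → ((ℕ → ℕ) → ℕ) → Set
ExtremalGraph δ Δ value = Σ Graph λ G → DegBounds G δ Δ × ∀ F → prodV G (F ∘ deg G) ≡ value F

regular-cone : ∀ {m δ} D (D0 : D 0 ≡ false) → δ < m → (∀ i → i < m → suc (distanceDegree m D i) ≡ δ) →
               ExtremalGraph δ m (λ F → F δ ^ m * F m)
regular-cone {m} {δ} D D0 δ<m regular =
  cone m D D0 , cone-DegBounds {m} {D} {D0} (<⇒≤ δ<m) bounds 0 0<m (regular 0 0<m) , value
  where
  0<m : 0 < m
  0<m = ≤-<-trans z≤n δ<m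
  bounds : ∀ i → i < m → δ ≤ suc (distanceDegree m D i) × suc (distanceDegree m D i) ≤ m
  bounds i i<m = ≤-reflexive (sym (regular i i<m)) , ≤-trans (≤-reflexive (regular i i<m)) (<⇒≤ δ<m)
  value : ∀ F → prodV (cone m D D0) (F ∘ deg (cone m D D0)) ≡ F δ ^ m * F m
  value F = trans (prodV-cone {m} {D} {D0} F)
                  (cong (_* F m) (productBelow-const m (λ i i<m → cong F (regular i i<m))))

almost-regular-cone : ∀ {m δ} D (D0 : D 0 ≡ false) → δ < m → ∀ s → 0 < s → s < m →
                      (∀ i → i < m → i ≢ s → suc (distanceDegree m D i) ≡ δ) → distanceDegree m D s ≡ δ →
                      ExtremalGraph δ m (λ F → F δ ^ (m ∸ 1) * F (suc δ) * F m)
almost-regular-cone {m} {δ} D D0 δ<m s 0<s s<m regular exceptional =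
  cone m D D0 , cone-DegBounds {m} {D} {D0} (<⇒≤ δ<m) bounds 0 0<m (regular 0 0<m 0≢s) , value
  where
  0<m : 0 < m
  0<m = <-trans 0<s s<m
  0≢s : 0 ≢ s
  0≢s = <⇒≢ 0<s
  bounds : ∀ i → i < m → δ ≤ suc (distanceDegree m D i) × suc (distanceDegree m D i) ≤ m
  bounds i i<m with i ≟ s
  ... | yes refl = ≤-trans (n≤1+n δ) (s≤s (≤-reflexive (sym exceptional))) ,
                   subst (_≤ m) (cong suc (sym exceptional)) δ<m
  ... | no  i≢s  = ≤-reflexive (sym (regular i i<m i≢s)) , ≤-trans (≤-reflexive (regular i i<m i≢s)) (<⇒≤ δ<m)
  value : ∀ F → prodV (cone m D D0) (F ∘ deg (cone m D D0)) ≡ F δ ^ (m ∸ 1) * F (suc δ) * F m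
  value F = begin
    prodV (cone m D D0) (F ∘ deg (cone m D D0))
      ≡⟨ prodV-cone {m} {D} {D0} F ⟩
    productBelow m (F ∘ suc ∘ distanceDegree m D) * F m
      ≡⟨ cong (_* F m) (productBelow-except m s s<m (λ i i<m i≢s → cong F (regular i i<m i≢s))) ⟩
    F δ ^ (m ∸ 1) * F (suc (distanceDegree m D s)) * F m
      ≡⟨ cong (λ d → F δ ^ (m ∸ 1) * F (suc d) * F m) exceptional ⟩
    F δ ^ (m ∸ 1) * F (suc δ) * F m ∎
    where open ≡-Reasoning

distanceDegree-∨ : ∀ {m i} (D E : ℕ → Bool) → (∀ x → D x ≡ true → E x ≡ false) →
                   distanceDegree m (λ x → D x ∨ E x) i ≡ distanceDegree m D i + distanceDegree m E i
distanceDegree-∨ {m} {i} D E disjoint = trans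
  (sumBelow-cong m (λ y _ → indicator-∨ (D ∣ i - y ∣) _ (disjoint _)))
  (sumBelow-distrib m _ _)

distanceDegree-≟ : ∀ {m i e} → 1 ≤ e → i ≤ m →
                   distanceDegree m (λ x → does (x ≟ e)) i ≡ indicator (does (e ≤? i)) + indicator (does (e <? m ∸ i))
distanceDegree-≟ {m} {i} {suc e} _ i≤m = begin
  distanceDegree m (λ x → does (x ≟ suc e)) i
    ≡⟨ sumBelow-distance-split (λ x → indicator (does (x ≟ suc e))) i≤m ⟩
  sumBelow i (λ y → indicator (does (i ∸ y ≟ suc e))) + sumBelow (m ∸ i) (λ x → indicator (does (x ≟ suc e)))
    ≡⟨ cong₂ _+_ (trans (sumBelow-reverse i (λ x → indicator (does (x ≟ suc e)))) (sumBelow-≟ i e))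
                 (sumBelow-≟ (m ∸ i) (suc e)) ⟩
  indicator (does (e <? i)) + indicator (does (suc e <? m ∸ i)) ∎
  where open ≡-Reasoning

-- For 0 < x < m: the cyclic distance min x (m ∸ x) is at most r.
circulant : ℕ → ℕ → ℕ → Bool
circulant m r x = does (1 ≤? x) ∧ (does (x ≤? r) ∨ does (m ≤? x + r))

circulant-reflect : ∀ {m r x y} → 0 < x → 0 < y → x + y ≡ m → circulant m r x ≡ circulant m r y
circulant-reflect {m} {r} {x} {y} 0<x 0<y x+y≡m
  rewrite dec-true (1 ≤? x) 0<x | dec-true (1 ≤? y) 0<y =
  trans (cong₂ _∨_ (does-⇔ (≤⇔≤+ x+y≡m) (x ≤? r) (m ≤? y + r))
                   (sym (does-⇔ (≤⇔≤+ (trans (+-comm y x) x+y≡m)) (y ≤? r) (m ≤? x + r))))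
        (∨-comm (does (m ≤? y + r)) (does (y ≤? r)))
  where
  ≤⇔≤+ : ∀ {a b} → a + b ≡ m → a ≤ r ⇔ m ≤ b + r
  ≤⇔≤+ {a} {b} refl = mk⇔ (λ a≤r → subst (a + b ≤_) (+-comm r b) (+-monoˡ-≤ b a≤r))
                            (λ m≤b+r → +-cancelʳ-≤ b a r (subst (a + b ≤_) (+-comm b r) m≤b+r))

sumBelow-circulant : ∀ {m r} → suc (r + r) ≤ m → sumBelow m (indicator ∘ circulant m r) ≡ r + r
sumBelow-circulant {m} {r} 2r<m =
  subst (λ k → sumBelow k (indicator ∘ circulant k r) ≡ r + r) (sym m-shape) (count (m ∸ suc (r + r)))
  where
  m-shape : m ≡ suc (r + (m ∸ suc (r + r) + r))
  m-shape = trans (sym (m+[n∸m]≡n 2r<m))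
                  (cong suc (trans (+-assoc r r _) (cong (r +_) (+-comm r (m ∸ suc (r + r))))))
  count : ∀ t → sumBelow (suc (r + (t + r))) (indicator ∘ circulant (suc (r + (t + r))) r) ≡ r + r
  count t = begin
    sumBelow (r + (t + r)) (c ∘ suc)
      ≡⟨ sumBelow-+ r (t + r) _ ⟩
    sumBelow r (λ x → c (suc x)) + sumBelow (t + r) (λ x → c (suc (r + x)))
      ≡⟨ cong (sumBelow r (λ x → c (suc x)) +_) (sumBelow-+ t r _) ⟩
    sumBelow r (λ x → c (suc x)) + (sumBelow t (λ x → c (suc (r + x))) + sumBelow r (λ x → c (suc (r + (t + x)))))
      ≡⟨ cong₂ _+_ (sumBelow-const r near-start) (cong₂ _+_ (sumBelow-const t middle) (sumBelow-const r near-end)) ⟩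
    r * 1 + (t * 0 + r * 1)
      ≡⟨ cong₂ _+_ (*-identityʳ r) (cong₂ _+_ (*-zeroʳ t) (*-identityʳ r)) ⟩
    r + r ∎
    where
    open ≡-Reasoning
    m₀ = suc (r + (t + r))
    c = indicator ∘ circulant m₀ r
    near-start : ∀ x → x < r → c (suc x) ≡ 1
    near-start x x<r rewrite dec-true (suc x ≤? r) x<r = refl
    far : ∀ {x} → x < t → suc (r + x) + r < m₀
    far {x} x<t = s≤s (subst (_< r + (t + r)) (sym (+-assoc r x r)) (+-monoʳ-< r (+-monoˡ-< r x<t)))
    close : ∀ x → m₀ ≤ suc (r + (t + x)) + r
    close x = s≤s (≤-trans (+-monoʳ-≤ r (+-monoˡ-≤ r (m≤m+n t x))) (≤-reflexive (sym (+-assoc r (t + x) r))))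
    middle : ∀ x → x < t → c (suc (r + x)) ≡ 0
    middle x x<t rewrite dec-false (suc (r + x) ≤? r) (<⇒≱ (s≤s (m≤m+n r x)))
                       | dec-false (m₀ ≤? suc (r + x) + r) (<⇒≱ (far x<t)) = refl
    near-end : ∀ x → x < r → c (suc (r + (t + x))) ≡ 1
    near-end x x<r rewrite dec-true (m₀ ≤? suc (r + (t + x)) + r) (close x)
                         | ∨-zeroʳ (does (suc (r + (t + x)) ≤? r)) = refl

distanceDegree-circulant : ∀ {m r i} → suc (r + r) ≤ m → i < m → distanceDegree m (circulant m r) i ≡ r + r
distanceDegree-circulant 2r<m i<m = trans
  (sumBelow-distance-reflect _ (λ _ _ 0<x 0<y x+y≡m → cong indicator (circulant-reflect 0<x 0<y x+y≡m)) i<m)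
  (sumBelow-circulant 2r<m)

circulant-far : ∀ {m r x} → r < x → x + r < m → circulant m r x ≡ false
circulant-far {m} {r} {x} r<x x+r<m
  rewrite dec-false (x ≤? r) (<⇒≱ r<x) | dec-false (m ≤? x + r) (<⇒≱ x+r<m) = ∧-zeroʳ (does (1 ≤? x))

circulant-disjoint-≟ : ∀ {m r e} → r < e → e + r < m → ∀ x → circulant m r x ≡ true → does (x ≟ e) ≡ false
circulant-disjoint-≟ {e = e} r<e e+r<m x cx with x ≟ e
... | no  x≢e  = dec-false (x ≟ e) x≢e
... | yes refl = contradiction (trans (sym cx) (circulant-far r<e e+r<m)) λ ()

extremal-circulant : ∀ {r Δ} → suc (r + r) < Δ →
                     ExtremalGraph (suc (r + r)) Δ (λ F → F (suc (r + r)) ^ Δ * F Δ)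
extremal-circulant {r} {Δ} δ<Δ =
  regular-cone (circulant Δ r) refl δ<Δ (λ i i<Δ → cong suc (distanceDegree-circulant (<⇒≤ δ<Δ) i<Δ))

chorded : ℕ → ℕ → ℕ → ℕ → Bool
chorded m r e x = circulant m r x ∨ does (x ≟ e)

distanceDegree-chorded : ∀ {m r e i} → r < e → e + r < m → i < m →
  distanceDegree m (chorded m r e) i ≡ r + r + (indicator (does (e ≤? i)) + indicator (does (e <? m ∸ i)))
distanceDegree-chorded {m} {r} {e} {i} r<e e+r<m i<m =
  trans (distanceDegree-∨ {m} {i} _ _ (circulant-disjoint-≟ r<e e+r<m))
        (cong₂ _+_ (distanceDegree-circulant {m} {r} (≤-trans (+-monoˡ-≤ r r<e) (<⇒≤ e+r<m)) i<m)
                   (distanceDegree-≟ (≤-trans (s≤s z≤n) r<e) (<⇒≤ i<m)))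

chorded-irrefl : ∀ {m r e} → 0 < e → chorded m r e 0 ≡ false
chorded-irrefl {e = e} 0<e = dec-false (0 ≟ e) (<⇒≢ 0<e)

antipodal-count : ∀ {p i} → i < p + p → indicator (does (p ≤? i)) + indicator (does (p <? p + p ∸ i)) ≡ 1
antipodal-count {p} {i} i<2p with p ≤? i
... | yes p≤i rewrite dec-true (p ≤? i) p≤i
                    | dec-false (p <? p + p ∸ i) (≤⇒≯ (m≤n+o⇒m∸n≤o (p + p) i (+-monoˡ-≤ p p≤i))) = refl
... | no  p≰i rewrite dec-false (p ≤? i) p≰i
                    | dec-true (p <? p + p ∸ i) (m+n≤o⇒m≤o∸n (suc p) (+-monoʳ-< p (≰⇒> p≰i))) = refl

near-antipodal-count : ∀ {s i} → i < suc (s + s) → i ≢ s →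
                       indicator (does (s ≤? i)) + indicator (does (s <? suc (s + s) ∸ i)) ≡ 1
near-antipodal-count {s} {i} i<m i≢s with <-cmp i s
... | tri< i<s _ _ rewrite dec-false (s ≤? i) (<⇒≱ i<s)
                         | dec-true (s <? suc (s + s) ∸ i) (m+n≤o⇒m≤o∸n (suc s) (s≤s (+-monoʳ-≤ s (<⇒≤ i<s)))) = refl
... | tri≈ _ i≡s _ = contradiction i≡s i≢s
... | tri> _ _ s<i rewrite dec-true (s ≤? i) (<⇒≤ s<i)
                         | dec-false (s <? suc (s + s) ∸ i) (≤⇒≯ (m≤n+o⇒m∸n≤o (suc (s + s)) i (+-monoˡ-≤ s s<i))) = refl

near-antipodal-count-centre : ∀ s → indicator (does (s ≤? s)) + indicator (does (s <? suc (s + s) ∸ s)) ≡ 2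
near-antipodal-count-centre s rewrite dec-true (s ≤? s) ≤-refl
                                    | dec-true (s <? suc (s + s) ∸ s) (m+n≤o⇒m≤o∸n (suc s) {s} ≤-refl) = refl

extremal-antipodal : ∀ {r p} → suc r + suc r < p + p →
                     ExtremalGraph (suc r + suc r) (p + p) (λ F → F (suc r + suc r) ^ (p + p) * F (p + p))
extremal-antipodal {r} {p} δ<Δ = regular-cone (chorded Δ r p) (chorded-irrefl {Δ} {r} 0<p) δ<Δ regular
  where
  Δ = p + p
  r<p : r < p
  r<p = <-trans (n<1+n r) (double-<⇒< δ<Δ)
  0<p : 0 < p
  0<p = ≤-<-trans z≤n r<p
  regular : ∀ i → i < Δ → suc (distanceDegree Δ (chorded Δ r p) i) ≡ suc r + suc r
  regular i i<Δ = cong suc (begin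
    distanceDegree Δ (chorded Δ r p) i         ≡⟨ distanceDegree-chorded r<p (+-monoʳ-< p r<p) i<Δ ⟩
    r + r + (indicator (does (p ≤? i)) + indicator (does (p <? Δ ∸ i)))
                                               ≡⟨ cong (r + r +_) (antipodal-count i<Δ) ⟩
    r + r + 1                                  ≡⟨ +-assoc r r 1 ⟩
    r + (r + 1)                                ≡⟨ cong (r +_) (+-comm r 1) ⟩
    r + suc r                                  ∎)
    where open ≡-Reasoning

-- The chords {i, i + s} of {0, …, 2s} give every vertex one extra neighbour, except s, which gets two.
extremal-near-antipodal : ∀ {r s} → r < s →
  ExtremalGraph (suc r + suc r) (suc (s + s))
                (λ F → F (suc r + suc r) ^ (s + s) * F (suc (suc r + suc r)) * F (suc (s + s)))
extremal-near-antipodal {r} {s} r<s =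
  almost-regular-cone (chorded Δ r s) (chorded-irrefl {Δ} {r} 0<s) δ<Δ s 0<s s<Δ regular exceptional
  where
  Δ = suc (s + s)
  0<s : 0 < s
  0<s = ≤-<-trans z≤n r<s
  s<Δ : s < Δ
  s<Δ = s≤s (m≤m+n s s)
  δ<Δ : suc r + suc r < Δ
  δ<Δ = s≤s (+-mono-≤ r<s r<s)
  s+r<Δ : s + r < Δ
  s+r<Δ = m<n⇒m<1+n (+-monoʳ-< s r<s)
  regular : ∀ i → i < Δ → i ≢ s → suc (distanceDegree Δ (chorded Δ r s) i) ≡ suc r + suc r
  regular i i<Δ i≢s = cong suc (begin
    distanceDegree Δ (chorded Δ r s) i     ≡⟨ distanceDegree-chorded r<s s+r<Δ i<Δ ⟩
    r + r + (indicator (does (s ≤? i)) + indicator (does (s <? Δ ∸ i)))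
                                           ≡⟨ cong (r + r +_) (near-antipodal-count i<Δ i≢s) ⟩
    r + r + 1                              ≡⟨ +-assoc r r 1 ⟩
    r + (r + 1)                            ≡⟨ cong (r +_) (+-comm r 1) ⟩
    r + suc r                              ∎)
    where open ≡-Reasoning
  exceptional : distanceDegree Δ (chorded Δ r s) s ≡ suc r + suc r
  exceptional = begin
    distanceDegree Δ (chorded Δ r s) s     ≡⟨ distanceDegree-chorded r<s s+r<Δ s<Δ ⟩
    r + r + (indicator (does (s ≤? s)) + indicator (does (s <? Δ ∸ s)))
                                           ≡⟨ cong (r + r +_) (near-antipodal-count-centre s) ⟩
    r + r + 2                              ≡⟨ +-assoc r r 2 ⟩
    r + (r + 2)                            ≡⟨ cong (r +_) (+-comm r 2) ⟩
    r + suc (suc r)                        ≡⟨ +-suc r (suc r) ⟩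
    suc r + suc r                          ∎
    where open ≡-Reasoning

extremal-even : ∀ {δ Δ} → 1 ≤ δ → δ < Δ → 2 ∣ Δ * suc δ → ExtremalGraph δ Δ (λ F → F δ ^ Δ * F Δ)
extremal-even {δ} {Δ} 1≤δ δ<Δ 2∣Δ[1+δ] with parity δ
... | inj₂ (r , refl)     = extremal-circulant {r} δ<Δ
... | inj₁ (zero , refl)  = contradiction 1≤δ λ ()
... | inj₁ (suc r , refl) with parity Δ
...   | inj₁ (p , refl) = extremal-antipodal {r} {p} δ<Δ
...   | inj₂ (p , refl) = ⊥-elim ([ 2∤odd p , 2∤odd (suc r) ]′ (euclidsLemma Δ (suc δ) prime[2] 2∣Δ[1+δ]))

extremal-odd : ∀ {δ Δ} → 1 ≤ δ → δ < Δ → 2 ∣ δ → ¬ 2 ∣ Δ →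
               ExtremalGraph δ Δ (λ F → F δ ^ (Δ ∸ 1) * F (suc δ) * F Δ)
extremal-odd {δ} {Δ} 1≤δ δ<Δ 2∣δ 2∤Δ with parity δ
... | inj₂ (q , refl)     = contradiction 2∣δ (2∤odd q)
... | inj₁ (zero , refl)  = contradiction 1≤δ λ ()
... | inj₁ (suc r , refl) with parity Δ
...   | inj₁ (p , refl) = contradiction (2∣double p) 2∤Δ
...   | inj₂ (s , refl) =
  extremal-near-antipodal {r} {s} (double-<⇒< (≤-trans (s≤s (+-monoʳ-≤ r (n≤1+n r))) (s≤s⁻¹ δ<Δ)))

theorem3p3 : ∀ (δ Δ : ℕ) → 1 ≤ δ → δ < Δ →
    ((2 ∣ Δ * suc δ) →
      ((∀ (G : Graph) → DegBounds G δ Δ →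
          (δ ^ (2 * Δ) * Δ ^ 2 ≤ Π₁ G)
          × (δ ^ Δ * Δ ≤ NK G)
          × (δ ^ (δ * Δ) * Δ ^ Δ ≤ NK* G))
       × Σ Graph (λ G → DegBounds G δ Δ × Π₁ G ≡ δ ^ (2 * Δ) * Δ ^ 2)
       × Σ Graph (λ G → DegBounds G δ Δ × NK G ≡ δ ^ Δ * Δ)
       × Σ Graph (λ G → DegBounds G δ Δ × NK* G ≡ δ ^ (δ * Δ) * Δ ^ Δ)))
    × ((¬ (2 ∣ Δ * suc δ)) →
      ((∀ (G : Graph) → DegBounds G δ Δ →
          (δ ^ (2 * (Δ ∸ 1)) * suc δ ^ 2 * Δ ^ 2 ≤ Π₁ G)
          × (δ ^ (Δ ∸ 1) * suc δ * Δ ≤ NK G)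
          × (δ ^ (δ * (Δ ∸ 1)) * suc δ ^ suc δ * Δ ^ Δ ≤ NK* G))
       × Σ Graph (λ G → DegBounds G δ Δ × Π₁ G ≡ δ ^ (2 * (Δ ∸ 1)) * suc δ ^ 2 * Δ ^ 2)
       × Σ Graph (λ G → DegBounds G δ Δ × NK G ≡ δ ^ (Δ ∸ 1) * suc δ * Δ)
       × Σ Graph (λ G → DegBounds G δ Δ × NK* G ≡ δ ^ (δ * (Δ ∸ 1)) * suc δ ^ suc δ * Δ ^ Δ)))
theorem3p3 δ Δ 1≤δ δ<Δ = even , odd
  where
  1≤δ^ : ∀ k → 1 ≤ δ ^ k
  1≤δ^ k = subst (_≤ δ ^ k) (^-zeroˡ k) (^-monoˡ-≤ k 1≤δ)
  even-form : ∀ k {x} → (δ ^ k) ^ Δ * x ≡ δ ^ (k * Δ) * x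
  even-form k {x} = cong (_* x) (^-*-assoc δ k Δ)
  odd-form : ∀ k {x y} → (δ ^ k) ^ (Δ ∸ 1) * x * y ≡ δ ^ (k * (Δ ∸ 1)) * x * y
  odd-form k {x} {y} = cong (λ z → z * x * y) (^-*-assoc δ k (Δ ∸ 1))
  even : 2 ∣ Δ * suc δ → _
  even 2∣Δ[1+δ] with extremal-even 1≤δ δ<Δ 2∣Δ[1+δ]
  ... | G , bounds , value =
    (λ H b → subst (_≤ Π₁ H) (even-form 2) (prodV-deg-≥ H (_^ 2) (^-monoˡ-≤ 2) (1≤δ^ 2) b) ,
             prodV-deg-≥ H id id 1≤δ b ,
             subst (_≤ NK* H) (even-form δ) (prodV-deg-≥ H (λ x → x ^ x) ^-self-mono (1≤δ^ δ) b)) ,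
    (G , bounds , trans (value (_^ 2)) (even-form 2)) ,
    (G , bounds , value id) ,
    (G , bounds , trans (value (λ x → x ^ x)) (even-form δ))
  odd : ¬ 2 ∣ Δ * suc δ → _
  odd 2∤Δ[1+δ] with 2∤*suc⇒2∤×2∣ Δ δ 2∤Δ[1+δ]
  ... | 2∤Δ , 2∣δ with extremal-odd 1≤δ δ<Δ 2∣δ 2∤Δ
  ...   | G , bounds , value =
    (λ H b → subst (_≤ Π₁ H) (odd-form 2) (prodV-deg-≥-odd H (_^ 2) (^-monoˡ-≤ 2) (1≤δ^ 2) 2∤Δ 2∣δ b) ,
             prodV-deg-≥-odd H id id 1≤δ 2∤Δ 2∣δ b ,
             subst (_≤ NK* H) (odd-form δ) (prodV-deg-≥-odd H (λ x → x ^ x) ^-self-mono (1≤δ^ δ) 2∤Δ 2∣δ b)) ,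
    (G , bounds , trans (value (_^ 2)) (odd-form 2)) ,
    (G , bounds , value id) ,
    (G , bounds , trans (value (λ x → x ^ x)) (odd-form δ))
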